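{- For every finite simple graph $G$, $Z_f(G) = Z^-(G)$.
   Context: All graphs are finite and simple. Skew zero forcing: initially some set of vertices of $G$ is colored blue and the rest white; the rule is: if $w$ is the only white neighbor of any vertex $u$ (blue or white), then $u$ may color $w$ blue. A skew zero forcing set is an initial blue set from which repeated application can make all vertices blue; $Z^-(G)$ is the minimum cardinality of a skew zero forcing set. For $r\in\mathbb{N}$, the $r$-blowup $G^{(r)}$ is obtained by replacing each vertex $u$ by an independent set $R_u$ of $r$ vertices and each edge $uw$ by all edges between $R_u$ and $R_w$. $r$-fold forcing game: an initial set $B\subseteq V(G^{(r)})$ is blue, the rest white; at each step, with $B_t$ the current blue set, if $u\in B_t$ and $|N(u)\setminus B_t|\le r$, then $u$ may color all of $N(u)\setminus B_t$ blue. $B$ is an $r$-fold forcing set if repeated application can make all of $G^{(r)}$ blue; $Z_{(r)}(G)$ is the minimum cardinality of an $r$-fold forcing set, and $Z_f(G)=\inf_{r\in\mathbb{N}} Z_{(r)}(G)/r$. -}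

module Defs where

open import Data.Nat using (ℕ; zero; suc; _≤_; _*_)
open import Data.Bool using (Bool; true; false; if_then_else_)
open import Data.Fin using (Fin; quotient)
open import Data.Fin.Subset using (Subset; inside; outside; _∈_; _∪_; _─_; ⁅_⁆; ∣_∣; ⊤)
open import Data.Vec using (tabulate)
open import Data.Product using (Σ; _×_; _,_; ∃; ∃-syntax)
open import Data.Integer using (+_)
open import Data.Rational using (ℚ; _/_) renaming (_≤_ to _≤ℚ_)
open import Relation.Binary.PropositionalEquality using (_≡_)
open import Relation.Binary.Construct.Closure.ReflexiveTransitive using (Star)

record SimpleGraph (n : ℕ) : Set where
  field
    adj    : Fin n → Fin n → Bool
    sym    : ∀ u v → adj u v ≡ adj v u
    irrefl : ∀ u → adj u u ≡ false
open SimpleGraph public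

N : ∀ {n} → SimpleGraph n → Fin n → Subset n
N G u = tabulate (λ v → if adj G u v then inside else outside)

SkewStep : ∀ {n} → SimpleGraph n → Subset n → Subset n → Set
SkewStep G B B' = ∃[ u ] ∃[ w ] ((N G u ─ B ≡ ⁅ w ⁆) × (B' ≡ B ∪ ⁅ w ⁆))

IsSkewZeroForcingSet : ∀ {n} → SimpleGraph n → Subset n → Set
IsSkewZeroForcingSet G B = Star (SkewStep G) B ⊤

IsMinCard : ∀ {n} → (Subset n → Set) → ℕ → Set
IsMinCard P m = (∃[ B ] (P B × ∣ B ∣ ≡ m)) × (∀ B → P B → m ≤ ∣ B ∣)

ZminusIs : ∀ {n} → SimpleGraph n → ℕ → Set
ZminusIs G m = IsMinCard (IsSkewZeroForcingSet G) m

-- r-blowup: vertex set Fin (n * r); vertex x lies in the class R_u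
-- with u = quotient r x.  x ~ y iff their classes are adjacent in G.
blowup : ∀ {n} → SimpleGraph n → (r : ℕ) → SimpleGraph (n * r)
blowup G r = record
  { adj    = λ x y → adj G (quotient r x) (quotient r y)
  ; sym    = λ x y → sym G (quotient r x) (quotient r y)
  ; irrefl = λ x → irrefl G (quotient r x)
  }

FoldStep : ∀ {m} → ℕ → SimpleGraph m → Subset m → Subset m → Set
FoldStep r H B B' =
  ∃[ u ] ((u ∈ B) × (∣ N H u ─ B ∣ ≤ r) × (B' ≡ B ∪ (N H u ─ B)))

IsFoldForcingSet : ∀ {n} → SimpleGraph n → (r : ℕ) → Subset (n * r) → Set
IsFoldForcingSet G r B = Star (FoldStep r (blowup G r)) B ⊤

ZfoldIs : ∀ {n} → SimpleGraph n → ℕ → ℕ → Set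
ZfoldIs G r m = IsMinCard (IsFoldForcingSet G r) m

ZfRatio : ∀ {n} → SimpleGraph n → ℚ → Set
ZfRatio G q = ∃[ r' ] ∃[ m ] (ZfoldIs G (suc r') m × q ≡ (+ m) / suc r')

IsInfimum : (ℚ → Set) → ℚ → Set
IsInfimum S q = (∀ x → S x → q ≤ℚ x) × (∀ y → (∀ x → S x → y ≤ℚ x) → y ≤ℚ q)

ZfIs : ∀ {n} → SimpleGraph n → ℚ → Set
ZfIs G q = IsInfimum (ZfRatio G) q

-- Reading an r-fold forcing process of G^(r) backwards projects it onto a skew forcing process
-- of G: a force by x ∈ R_u that colours some z ∈ R_w becomes the skew force of w by u, because
-- every class adjacent to u lies in N(x) and is therefore blue afterwards.  Each such force
-- colours at most r vertices, so Z_(r)(G) ≥ r·Z⁻(G).  Conversely, the blowup of a skew forcing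
-- set together with one vertex of every class is an r-fold forcing set (that vertex of R_u
-- forces R_w), so Z_(r)(G) ≤ r·Z⁻(G) + n.  Hence Z⁻ ≤ Z_(r)/r ≤ Z⁻ + n/r, and the infimum is Z⁻.
module Submission where

open import Defs hiding (sym)
open import Data.Nat using (ℕ; suc; _+_; _*_; _≤_; _<_; s≤s; z≤n)
import Data.Nat.Properties as ℕ
open import Data.Nat.Induction using (<-rec)
open import Data.Nat.Tactic.RingSolver using (solve-∀)
open import Data.Bool using (true; false; if_then_else_)
open import Data.Fin using (Fin; zero; quotient; remainder; combine)
open import Data.Fin.Properties using (remQuot-combine; combine-remQuot; _≟_)
open import Data.Fin.Subset
open import Data.Fin.Subset.Properties
open import Data.Vec using ([]; _∷_; _++_; concat; map; lookup; here; there)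
open import Data.Vec.Properties
  using (lookup-concat; lookup-map; lookup∘tabulate; []=⇒lookup; lookup⇒[]=)
open import Data.Integer as ℤ using (+_; -[1+_]; +≤+; +<+)
import Data.Integer.Properties as ℤ
open import Data.Rational as ℚ using (mkℚ; _/_; toℚᵘ; ↧ₙ_)
import Data.Rational.Properties as ℚ
open import Data.Rational.Unnormalised as ℚᵘ using (mkℚᵘ; *≤*; *<*)
import Data.Rational.Unnormalised.Properties as ℚᵘ
open import Data.Product using (∃-syntax; _×_; _,_; proj₁)
open import Data.Sum using (inj₁; inj₂)
open import Data.Empty using (⊥-elim)
open import Function using (_∘_; _⇔_; mk⇔; Equivalence)
open import Relation.Binary.PropositionalEquality
open import Relation.Binary.Construct.Closure.ReflexiveTransitive using (Star; ε; _◅_; gmap)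
open import Relation.Nullary using (¬_; yes; no; contradiction)

private
  variable
    m n : ℕ
    x : Fin n
    p q a : Subset n

x∈p─q⇒x∉q : ∀ (p q : Subset n) → x ∈ p ─ q → x ∉ q
x∈p─q⇒x∉q (inside  ∷ p) (outside ∷ q) here        ()
x∈p─q⇒x∉q (_       ∷ p) (_       ∷ q) (there x∈) (there x∈q) = x∈p─q⇒x∉q p q x∈ x∈q

p⊆q∪p─q : ∀ (p q : Subset n) → p ⊆ q ∪ (p ─ q)
p⊆q∪p─q p q {x} x∈p with x ∈? q
... | yes x∈q = x∈p∪q⁺ (inj₁ x∈q)
... | no  x∉q = x∈p∪q⁺ (inj₂ (x∈p∧x∉q⇒x∈p─q x∈p x∉q))

∣p∪q∣≤∣p∣+∣q∣ : ∀ (p q : Subset n) → ∣ p ∪ q ∣ ≤ ∣ p ∣ + ∣ q ∣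
∣p∪q∣≤∣p∣+∣q∣ []            []            = z≤n
∣p∪q∣≤∣p∣+∣q∣ (inside  ∷ p) (inside  ∷ q) =
  s≤s (ℕ.≤-trans (∣p∪q∣≤∣p∣+∣q∣ p q) (ℕ.+-monoʳ-≤ ∣ p ∣ (ℕ.n≤1+n ∣ q ∣)))
∣p∪q∣≤∣p∣+∣q∣ (inside  ∷ p) (outside ∷ q) = s≤s (∣p∪q∣≤∣p∣+∣q∣ p q)
∣p∪q∣≤∣p∣+∣q∣ (outside ∷ p) (inside  ∷ q) =
  subst (suc ∣ p ∪ q ∣ ≤_) (sym (ℕ.+-suc ∣ p ∣ ∣ q ∣)) (s≤s (∣p∪q∣≤∣p∣+∣q∣ p q))
∣p∪q∣≤∣p∣+∣q∣ (outside ∷ p) (outside ∷ q) = ∣p∪q∣≤∣p∣+∣q∣ p q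

∣p++q∣≡∣p∣+∣q∣ : ∀ (p : Subset m) (q : Subset n) → ∣ p ++ q ∣ ≡ ∣ p ∣ + ∣ q ∣
∣p++q∣≡∣p∣+∣q∣ []            q = refl
∣p++q∣≡∣p∣+∣q∣ (inside  ∷ p) q = cong suc (∣p++q∣≡∣p∣+∣q∣ p q)
∣p++q∣≡∣p∣+∣q∣ (outside ∷ p) q = ∣p++q∣≡∣p∣+∣q∣ p q

x∈p⇒⁅x⁆⊆p : x ∈ p → ⁅ x ⁆ ⊆ p
x∈p⇒⁅x⁆⊆p {x = x} x∈p y∈⁅x⁆ rewrite x∈⁅y⁆⇒x≡y x y∈⁅x⁆ = x∈p

x∈p⇒p-x∪⁅x⁆≡p : x ∈ p → (p - x) ∪ ⁅ x ⁆ ≡ p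
x∈p⇒p-x∪⁅x⁆≡p {x = x} {p} x∈p = ⊆-antisym ⊆p p⊆
  where
  ⊆p : (p - x) ∪ ⁅ x ⁆ ⊆ p
  ⊆p y∈ with x∈p∪q⁻ (p - x) ⁅ x ⁆ y∈
  ... | inj₁ y∈p-x = p─q⊆p p ⁅ x ⁆ y∈p-x
  ... | inj₂ y∈⁅x⁆ rewrite x∈⁅y⁆⇒x≡y x y∈⁅x⁆ = x∈p
  p⊆ : p ⊆ (p - x) ∪ ⁅ x ⁆
  p⊆ {y} y∈p with y ≟ x
  ... | yes refl = x∈p∪q⁺ (inj₂ (x∈⁅x⁆ x))
  ... | no  y≢x  = x∈p∪q⁺ (inj₁ (x∈p∧x≢y⇒x∈p-y y∈p y≢x))

x∈p⊆q⇒p─[q-x]≡⁅x⁆ : x ∈ p → p ⊆ q → p ─ (q - x) ≡ ⁅ x ⁆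
x∈p⊆q⇒p─[q-x]≡⁅x⁆ {x = x} {p} {q} x∈p p⊆q = ⊆-antisym ⊆⁅x⁆ ⁅x⁆⊆
  where
  ⊆⁅x⁆ : p ─ (q - x) ⊆ ⁅ x ⁆
  ⊆⁅x⁆ {y} y∈ with y ≟ x
  ... | yes refl = x∈⁅x⁆ x
  ... | no  y≢x  =
    contradiction (x∈p∧x≢y⇒x∈p-y (p⊆q (p─q⊆p p (q - x) y∈)) y≢x) (x∈p─q⇒x∉q p (q - x) y∈)
  ⁅x⁆⊆ : ⁅ x ⁆ ⊆ p ─ (q - x)
  ⁅x⁆⊆ y∈⁅x⁆ rewrite x∈⁅y⁆⇒x≡y x y∈⁅x⁆ =
    x∈p∧x∉q⇒x∈p─q x∈p (λ x∈q-x → x∈p─q⇒x∉q q ⁅ x ⁆ x∈q-x (x∈⁅x⁆ x))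

∪-─-absorb : q ⊆ p → p ─ a ⊆ q → a ∪ q ≡ a ∪ (p ─ a)
∪-─-absorb {q = q} {p} {a} q⊆p p─a⊆q = ⊆-antisym ⊆ʳ ⊆ˡ
  where
  ⊆ʳ : a ∪ q ⊆ a ∪ (p ─ a)
  ⊆ʳ y∈ with x∈p∪q⁻ a q y∈
  ... | inj₁ y∈a = x∈p∪q⁺ (inj₁ y∈a)
  ... | inj₂ y∈q = p⊆q∪p─q p a (q⊆p y∈q)
  ⊆ˡ : a ∪ (p ─ a) ⊆ a ∪ q
  ⊆ˡ y∈ with x∈p∪q⁻ a (p ─ a) y∈
  ... | inj₁ y∈a = x∈p∪q⁺ (inj₁ y∈a)
  ... | inj₂ y∈p─a = x∈p∪q⁺ (inj₂ (p─a⊆q y∈p─a))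

infixr 7 _⊗_

-- Opaque, so that unification can read p and q off p ⊗ q.
opaque
  _⊗_ : Subset m → Subset n → Subset (m * n)
  p ⊗ q = concat (map (λ s → if s then q else ⊥) p)

  ∣p⊗q∣≡∣p∣*∣q∣ : ∀ (p : Subset m) (q : Subset n) → ∣ p ⊗ q ∣ ≡ ∣ p ∣ * ∣ q ∣
  ∣p⊗q∣≡∣p∣*∣q∣ []            q = refl
  ∣p⊗q∣≡∣p∣*∣q∣ (inside ∷ p) q =
    trans (∣p++q∣≡∣p∣+∣q∣ q (p ⊗ q)) (cong (_+_ ∣ q ∣) (∣p⊗q∣≡∣p∣*∣q∣ p q))
  ∣p⊗q∣≡∣p∣*∣q∣ {n = n} (outside ∷ p) q =
    trans (∣p++q∣≡∣p∣+∣q∣ (⊥ {n}) (p ⊗ q)) (cong₂ _+_ (∣⊥∣≡0 n) (∣p⊗q∣≡∣p∣*∣q∣ p q))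

  combine∈p⊗q⇔ : ∀ {p : Subset m} {q : Subset n} {i j} → combine i j ∈ p ⊗ q ⇔ (i ∈ p × j ∈ q)
  combine∈p⊗q⇔ {n = n} {p = p} {q} {i} {j} = mk⇔ to from
    where
    row : Side → Subset n
    row s = if s then q else ⊥
    lookup-⊗ : ∀ {s} → lookup p i ≡ s → lookup (p ⊗ q) (combine i j) ≡ lookup (row s) j
    lookup-⊗ refl =
      trans (lookup-concat (map row p) i j) (cong (λ r → lookup r j) (lookup-map i row p))
    to : combine i j ∈ p ⊗ q → i ∈ p × j ∈ q
    to ij∈ with lookup p i in eq
    ... | inside  =
      lookup⇒[]= i p eq , lookup⇒[]= j q (trans (sym (lookup-⊗ eq)) ([]=⇒lookup ij∈))
    ... | outside =
      contradiction (lookup⇒[]= j (⊥ {n}) (trans (sym (lookup-⊗ eq)) ([]=⇒lookup ij∈))) ∉⊥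
    from : i ∈ p × j ∈ q → combine i j ∈ p ⊗ q
    from (i∈p , j∈q) =
      lookup⇒[]= (combine i j) (p ⊗ q) (trans (lookup-⊗ ([]=⇒lookup i∈p)) ([]=⇒lookup j∈q))

x∈p⊗q⇔ : ∀ (p : Subset m) (q : Subset n) {z} →
         z ∈ p ⊗ q ⇔ (quotient n z ∈ p × remainder {m} n z ∈ q)
x∈p⊗q⇔ {m} {n} p q {z} =
  subst (λ z′ → z′ ∈ p ⊗ q ⇔ (quotient n z ∈ p × remainder {m} n z ∈ q))
        (combine-remQuot {m} n z) combine∈p⊗q⇔

x∈p⊗q⁻ : ∀ (p : Subset m) (q : Subset n) {z} → z ∈ p ⊗ q → quotient n z ∈ p × remainder {m} n z ∈ q
x∈p⊗q⁻ p q = Equivalence.to (x∈p⊗q⇔ p q)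

x∈p⊗q⁺ : ∀ {p : Subset m} {q : Subset n} {z} → quotient n z ∈ p × remainder {m} n z ∈ q → z ∈ p ⊗ q
x∈p⊗q⁺ {p = p} {q} = Equivalence.from (x∈p⊗q⇔ p q)

⊗-monoˡ : ∀ {p p′ : Subset m} {q : Subset n} → p ⊆ p′ → p ⊗ q ⊆ p′ ⊗ q
⊗-monoˡ {p = p} {q = q} p⊆p′ z∈ with x∈p⊗q⁻ p q z∈
... | qz∈p , rz∈q = x∈p⊗q⁺ (p⊆p′ qz∈p , rz∈q)

⊗-distribʳ-∪ : ∀ (p p′ : Subset m) (q : Subset n) → (p ∪ p′) ⊗ q ≡ p ⊗ q ∪ p′ ⊗ q
⊗-distribʳ-∪ p p′ q = ⊆-antisym ⊆ʳ ⊆ˡ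
  where
  ⊆ʳ : (p ∪ p′) ⊗ q ⊆ p ⊗ q ∪ p′ ⊗ q
  ⊆ʳ z∈ with x∈p⊗q⁻ (p ∪ p′) q z∈
  ... | qz∈ , rz∈q with x∈p∪q⁻ p p′ qz∈
  ...   | inj₁ qz∈p  = x∈p∪q⁺ (inj₁ (x∈p⊗q⁺ (qz∈p , rz∈q)))
  ...   | inj₂ qz∈p′ = x∈p∪q⁺ (inj₂ (x∈p⊗q⁺ (qz∈p′ , rz∈q)))
  ⊆ˡ : p ⊗ q ∪ p′ ⊗ q ⊆ (p ∪ p′) ⊗ q
  ⊆ˡ z∈ with x∈p∪q⁻ (p ⊗ q) (p′ ⊗ q) z∈
  ... | inj₁ z∈p⊗q  = ⊗-monoˡ (p⊆p∪q {p = p} p′) z∈p⊗q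
  ... | inj₂ z∈p′⊗q = ⊗-monoˡ (q⊆p∪q p p′) z∈p′⊗q

lookup-N : ∀ (G : SimpleGraph n) u v → lookup (N G u) v ≡ adj G u v
lookup-N G u v = trans (lookup∘tabulate _ v) (if-inside-outside (adj G u v))
  where
  if-inside-outside : ∀ b → (if b then inside else outside) ≡ b
  if-inside-outside true  = refl
  if-inside-outside false = refl

∈N⇔ : ∀ (G : SimpleGraph n) {u v} → v ∈ N G u ⇔ adj G u v ≡ true
∈N⇔ G {u} {v} = mk⇔
  (λ v∈ → trans (sym (lookup-N G u v)) ([]=⇒lookup v∈))
  (λ uv → lookup⇒[]= v (N G u) (trans (lookup-N G u v) uv))

-- ⋃_{v ∈ T} R_v, where the class R_v of the r-blowup consists of the z with quotient r z ≡ v.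
classes : ∀ r → Subset n → Subset (n * r)
classes r T = T ⊗ ⊤

∣classes∣ : ∀ r (T : Subset n) → ∣ classes r T ∣ ≡ ∣ T ∣ * r
∣classes∣ r T = trans (∣p⊗q∣≡∣p∣*∣q∣ T ⊤) (cong (∣ T ∣ *_) (∣⊤∣≡n r))

N-blowup : ∀ (G : SimpleGraph n) r x → N (blowup G r) x ≡ classes r (N G (quotient r x))
N-blowup G r x = ⊆-antisym
  (λ z∈ → x∈p⊗q⁺ (Equivalence.from (∈N⇔ G) (Equivalence.to (∈N⇔ (blowup G r)) z∈) , ∈⊤))
  (λ z∈ → Equivalence.from (∈N⇔ (blowup G r))
             (Equivalence.to (∈N⇔ G) (proj₁ (x∈p⊗q⁻ (N G (quotient r x)) ⊤ z∈))))

module _ {n : ℕ} (G : SimpleGraph n) (r : ℕ) where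

  private
    H : SimpleGraph (n * r)
    H = blowup G r

  Covers : Subset (n * r) → Fin n → Set
  Covers C v = classes r ⁅ v ⁆ ⊆ C

  record SkewShadow (C : Subset (n * r)) : Set where
    field
      S       : Subset n
      skew    : IsSkewZeroForcingSet G S
      covered : ∀ {v} → Covers C v → v ∈ S
      bound   : r * ∣ S ∣ ≤ ∣ C ∣

  shadow-⊤ : SkewShadow ⊤
  shadow-⊤ = record
    { S = ⊤ ; skew = ε ; covered = λ _ → ∈⊤
    ; bound = ℕ.≤-reflexive (begin
        r * ∣ ⊤ {n} ∣  ≡⟨ cong (r *_) (∣⊤∣≡n n) ⟩
        r * n          ≡⟨ ℕ.*-comm r n ⟩
        n * r          ≡⟨ ∣⊤∣≡n (n * r) ⟨
        ∣ ⊤ {n * r} ∣  ∎) }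
    where open ≡-Reasoning

  shadow-idle : ∀ {C D} → Empty D → SkewShadow (C ∪ D) → SkewShadow C
  shadow-idle {C} {D} empty sh = record
    { S = S ; skew = skew
    ; covered = λ cov → covered (⊆-trans cov (p⊆p∪q D))
    ; bound = ℕ.≤-trans bound (ℕ.≤-trans (∣p∪q∣≤∣p∣+∣q∣ C D) (ℕ.≤-reflexive ∣C∣+∣D∣≡∣C∣)) }
    where
    open SkewShadow sh
    ∣C∣+∣D∣≡∣C∣ : ∣ C ∣ + ∣ D ∣ ≡ ∣ C ∣
    ∣C∣+∣D∣≡∣C∣ rewrite Empty-unique empty | ∣⊥∣≡0 (n * r) = ℕ.+-identityʳ ∣ C ∣

  shadow-force : ∀ {C x z} → let D = N H x ─ C in
                 x ∈ C → ∣ D ∣ ≤ r → z ∈ D → SkewShadow (C ∪ D) → SkewShadow C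
  shadow-force {C} {x} {z} x∈C ∣D∣≤r z∈D sh = record
    { S = S′ - w
    ; skew = (u , w , x∈p⊆q⇒p─[q-x]≡⁅x⁆ w∈Nu Nu⊆S′ , sym (x∈p⇒p-x∪⁅x⁆≡p (Nu⊆S′ w∈Nu)))
             ◅ skew′
    ; covered = λ cov →
        x∈p∧x≢y⇒x∈p-y (covered′ (⊆-trans cov (p⊆p∪q D))) (λ { refl → w-uncovered cov })
    ; bound = ℕ.+-cancelˡ-≤ r (r * ∣ S′ - w ∣) ∣ C ∣ (begin
        r + r * ∣ S′ - w ∣  ≡⟨ ℕ.*-suc r ∣ S′ - w ∣ ⟨
        r * suc ∣ S′ - w ∣  ≤⟨ ℕ.*-monoʳ-≤ r (x∈p⇒∣p-x∣<∣p∣ (Nu⊆S′ w∈Nu)) ⟩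
        r * ∣ S′ ∣          ≤⟨ bound′ ⟩
        ∣ C ∪ D ∣           ≤⟨ ∣p∪q∣≤∣p∣+∣q∣ C D ⟩
        ∣ C ∣ + ∣ D ∣       ≤⟨ ℕ.+-monoʳ-≤ ∣ C ∣ ∣D∣≤r ⟩
        ∣ C ∣ + r           ≡⟨ ℕ.+-comm ∣ C ∣ r ⟩
        r + ∣ C ∣           ∎) }
    where
    open ℕ.≤-Reasoning
    open SkewShadow sh renaming (S to S′; skew to skew′; covered to covered′; bound to bound′)
    D : Subset (n * r)
    D = N H x ─ C
    u w : Fin n
    u = quotient r x
    w = quotient r z
    NH≡ : N H x ≡ classes r (N G u)
    NH≡ = N-blowup G r x
    -- Every class adjacent to u lies in N H x ⊆ C ∪ D, so it is covered.
    Nu⊆S′ : N G u ⊆ S′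
    Nu⊆S′ v∈Nu = covered′ λ z′∈Rv →
      p⊆q∪p─q (N H x) C (subst (_ ∈_) (sym NH≡) (⊗-monoˡ (x∈p⇒⁅x⁆⊆p v∈Nu) z′∈Rv))
    w∈Nu : w ∈ N G u
    w∈Nu = proj₁ (x∈p⊗q⁻ (N G u) ⊤ (subst (z ∈_) NH≡ (p─q⊆p (N H x) C z∈D)))
    w-uncovered : ¬ Covers C w
    w-uncovered cov = x∈p─q⇒x∉q (N H x) C z∈D (cov (x∈p⊗q⁺ (x∈⁅x⁆ w , ∈⊤)))

  shadow : ∀ {C} → Star (FoldStep r H) C ⊤ → SkewShadow C
  shadow ε = shadow-⊤
  shadow {C} ((x , x∈C , ∣D∣≤r , refl) ◅ forcing) with nonempty? (N H x ─ C)
  ... | yes (z , z∈D) = shadow-force x∈C ∣D∣≤r z∈D (shadow forcing)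
  ... | no  ∄z        = shadow-idle ∄z (shadow forcing)

module _ {n : ℕ} (G : SimpleGraph n) (r-1 : ℕ) where

  private
    r : ℕ
    r = suc r-1
    H : SimpleGraph (n * r)
    H = blowup G r

  representatives : Subset (n * r)
  representatives = ⊤ {n} ⊗ ⁅ zero {r-1} ⁆

  ∣representatives∣ : ∣ representatives ∣ ≡ n
  ∣representatives∣ = begin
    ∣ ⊤ {n} ⊗ ⁅ zero ⁆ ∣          ≡⟨ ∣p⊗q∣≡∣p∣*∣q∣ ⊤ ⁅ zero ⁆ ⟩
    ∣ ⊤ {n} ∣ * ∣ ⁅ zero {r-1} ⁆ ∣  ≡⟨ cong₂ _*_ (∣⊤∣≡n n) (∣⁅x⁆∣≡1 (zero {r-1})) ⟩
    n * 1                         ≡⟨ ℕ.*-identityʳ n ⟩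
    n                             ∎
    where open ≡-Reasoning

  inflate : Subset n → Subset (n * r)
  inflate T = classes r T ∪ representatives

  ∣inflate∣≤ : ∀ T → ∣ inflate T ∣ ≤ ∣ T ∣ * r + n
  ∣inflate∣≤ T = begin
    ∣ classes r T ∪ representatives ∣      ≤⟨ ∣p∪q∣≤∣p∣+∣q∣ (classes r T) representatives ⟩
    ∣ classes r T ∣ + ∣ representatives ∣  ≡⟨ cong₂ _+_ (∣classes∣ r T) ∣representatives∣ ⟩
    ∣ T ∣ * r + n                          ∎
    where open ℕ.≤-Reasoning

  inflate-⊤ : inflate ⊤ ≡ ⊤
  inflate-⊤ = ⊆-antisym ⊆⊤ (λ _ → x∈p∪q⁺ (inj₁ (x∈p⊗q⁺ (∈⊤ , ∈⊤))))

  inflate-∪ : ∀ T T′ → inflate (T ∪ T′) ≡ inflate T ∪ classes r T′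
  inflate-∪ T T′ = begin
    classes r (T ∪ T′) ∪ R                  ≡⟨ cong (_∪ R) (⊗-distribʳ-∪ T T′ ⊤) ⟩
    (classes r T ∪ classes r T′) ∪ R        ≡⟨ ∪-assoc (classes r T) (classes r T′) R ⟩
    classes r T ∪ (classes r T′ ∪ R)        ≡⟨ cong (classes r T ∪_) (∪-comm (classes r T′) R) ⟩
    classes r T ∪ (R ∪ classes r T′)        ≡⟨ ∪-assoc (classes r T) R (classes r T′) ⟨
    (classes r T ∪ R) ∪ classes r T′        ∎
    where
    open ≡-Reasoning
    R : Subset (n * r)
    R = representatives

  fold-of-skew : ∀ {T T′} → SkewStep G T T′ → FoldStep r H (inflate T) (inflate T′)
  fold-of-skew {T} (u , w , Nu─T≡⁅w⁆ , refl) = u₀ , u₀∈inflate , ∣white∣≤r , inflate-after-force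
    where
    u₀ : Fin (n * r)
    u₀ = combine u zero
    NHu₀≡ : N H u₀ ≡ classes r (N G u)
    NHu₀≡ = trans (N-blowup G r u₀) (cong (classes r ∘ N G ∘ proj₁) (remQuot-combine u zero))
    w∈Nu : w ∈ N G u
    w∈Nu = p─q⊆p (N G u) T (subst (w ∈_) (sym Nu─T≡⁅w⁆) (x∈⁅x⁆ w))
    u₀∈inflate : u₀ ∈ inflate T
    u₀∈inflate = x∈p∪q⁺ (inj₂ (Equivalence.from combine∈p⊗q⇔ (∈⊤ , x∈⁅x⁆ zero)))
    white⊆Rw : N H u₀ ─ inflate T ⊆ classes r ⁅ w ⁆
    white⊆Rw {z} z∈ = x∈p⊗q⁺ (subst (quotient r z ∈_) Nu─T≡⁅w⁆ (x∈p∧x∉q⇒x∈p─q qz∈Nu qz∉T) , ∈⊤)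
      where
      qz∈Nu : quotient r z ∈ N G u
      qz∈Nu = proj₁ (x∈p⊗q⁻ (N G u) ⊤ (subst (z ∈_) NHu₀≡ (p─q⊆p (N H u₀) (inflate T) z∈)))
      qz∉T : quotient r z ∉ T
      qz∉T qz∈T = x∈p─q⇒x∉q (N H u₀) (inflate T) z∈ (x∈p∪q⁺ (inj₁ (x∈p⊗q⁺ (qz∈T , ∈⊤))))
    Rw⊆NHu₀ : classes r ⁅ w ⁆ ⊆ N H u₀
    Rw⊆NHu₀ = subst (classes r ⁅ w ⁆ ⊆_) (sym NHu₀≡) (⊗-monoˡ (x∈p⇒⁅x⁆⊆p w∈Nu))
    ∣white∣≤r : ∣ N H u₀ ─ inflate T ∣ ≤ r
    ∣white∣≤r = begin
      ∣ N H u₀ ─ inflate T ∣  ≤⟨ p⊆q⇒∣p∣≤∣q∣ white⊆Rw ⟩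
      ∣ classes r ⁅ w ⁆ ∣     ≡⟨ ∣classes∣ r ⁅ w ⁆ ⟩
      ∣ ⁅ w ⁆ ∣ * r           ≡⟨ cong (_* r) (∣⁅x⁆∣≡1 w) ⟩
      1 * r                   ≡⟨ ℕ.*-identityˡ r ⟩
      r                       ∎
      where open ℕ.≤-Reasoning
    inflate-after-force : inflate (T ∪ ⁅ w ⁆) ≡ inflate T ∪ (N H u₀ ─ inflate T)
    inflate-after-force = trans (inflate-∪ T ⁅ w ⁆) (∪-─-absorb Rw⊆NHu₀ white⊆Rw)

  inflate-forcing : ∀ {T} → IsSkewZeroForcingSet G T → IsFoldForcingSet G r (inflate T)
  inflate-forcing {T} forcing =
    subst (Star (FoldStep r H) (inflate T)) inflate-⊤ (gmap inflate fold-of-skew forcing)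

toℚᵘ-+/ : ∀ a c → toℚᵘ ((+ a) / suc c) ℚᵘ.≃ mkℚᵘ (+ a) c
toℚᵘ-+/ a c = ℚ.toℚᵘ-fromℚᵘ (mkℚᵘ (+ a) c)

+*+ : ∀ a b → + a ℤ.* + b ≡ + (a * b)
+*+ a b = sym (ℤ.pos-* a b)

+/≤+/⁺ : ∀ {a b c d} → a * suc d ≤ b * suc c → (+ a) / suc c ℚ.≤ (+ b) / suc d
+/≤+/⁺ {a} {b} {c} {d} h = ℚ.toℚᵘ-cancel-≤
  (ℚᵘ.≤-respˡ-≃ (ℚᵘ.≃-sym (toℚᵘ-+/ a c)) (ℚᵘ.≤-respʳ-≃ (ℚᵘ.≃-sym (toℚᵘ-+/ b d))
    (*≤* (subst₂ ℤ._≤_ (sym (+*+ a (suc d))) (sym (+*+ b (suc c))) (+≤+ h)))))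

+/<+/⇔ : ∀ {a b c d} → (+ a) / suc c ℚ.< (+ b) / suc d ⇔ a * suc d < b * suc c
+/<+/⇔ {a} {b} {c} {d} = mk⇔ to from
  where
  to : (+ a) / suc c ℚ.< (+ b) / suc d → a * suc d < b * suc c
  to p with ℚᵘ.<-respˡ-≃ (toℚᵘ-+/ a c) (ℚᵘ.<-respʳ-≃ (toℚᵘ-+/ b d) (ℚ.toℚᵘ-mono-< p))
  ... | *<* h = ℤ.drop‿+<+ (subst₂ ℤ._<_ (+*+ a (suc d)) (+*+ b (suc c)) h)
  from : a * suc d < b * suc c → (+ a) / suc c ℚ.< (+ b) / suc d
  from h = ℚ.toℚᵘ-cancel-<
    (ℚᵘ.<-respˡ-≃ (ℚᵘ.≃-sym (toℚᵘ-+/ a c)) (ℚᵘ.<-respʳ-≃ (ℚᵘ.≃-sym (toℚᵘ-+/ b d))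
      (*<* (subst₂ ℤ._<_ (sym (+*+ a (suc d))) (sym (+*+ b (suc c))) (+<+ h)))))

above-nat-is-nat-fraction : ∀ {k} y → (+ k) / 1 ℚ.< y → ∃[ a ] y ≡ (+ a) / ↧ₙ y
above-nat-is-nat-fraction y@(mkℚ (+ a) _ _) _ = a , sym (ℚ.↥p/↧p≡p y)
above-nat-is-nat-fraction {k} y@(mkℚ -[1+ _ ] _ _) k<y =
  ⊥-elim (ℚ.<-asym k<y (ℚ.<-≤-trans (ℚ.negative⁻¹ y) 0≤k))
  where
  0≤k : ℚ.0ℚ ℚ.≤ (+ k) / 1
  0≤k = ℚ.nonNegative⁻¹ ((+ k) / 1) {{ℚ.normalize-nonNeg k 1}}

cross-<-of-small-excess : ∀ k n d a m → k * d < a → m ≤ k * suc (n * d) + n →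
                          m * d < a * suc (n * d)
cross-<-of-small-excess k n d a m kd<a m≤ = begin-strict
  m * d                           ≤⟨ ℕ.*-monoˡ-≤ d m≤ ⟩
  (k * r + n) * d                 ≡⟨ ℕ.*-distribʳ-+ d (k * r) n ⟩
  k * r * d + n * d               <⟨ ℕ.+-monoʳ-< (k * r * d) (ℕ.n<1+n (n * d)) ⟩
  k * r * d + r                   ≡⟨ regroup k r d ⟩
  suc (k * d) * r                 ≤⟨ ℕ.*-monoˡ-≤ r kd<a ⟩
  a * r                           ∎
  where
  open ℕ.≤-Reasoning
  r : ℕ
  r = suc (n * d)
  regroup : ∀ k r d → k * r * d + r ≡ suc (k * d) * r
  regroup = solve-∀

-- For r = 1 + n·↧y:  (k r + n)/r = k + n/r < k + 1/↧y ≤ y.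
/-<-of-small-excess : ∀ {k n m} y → (+ k) / 1 ℚ.< y → m ≤ k * suc (n * ↧ₙ y) + n →
                      (+ m) / suc (n * ↧ₙ y) ℚ.< y
/-<-of-small-excess {k} {n} {m} y k<y m≤ with above-nat-is-nat-fraction {k} y k<y
... | a , y≡ = subst ((+ m) / suc (n * ↧ₙ y) ℚ.<_) (sym y≡)
  (Equivalence.from (+/<+/⇔ {m} {a}) (cross-<-of-small-excess k n (↧ₙ y) a m kd<a m≤))
  where
  kd<a : k * ↧ₙ y < a
  kd<a = subst (k * ↧ₙ y <_) (ℕ.*-identityʳ a)
    (Equivalence.to (+/<+/⇔ {k} {a}) (subst ((+ k) / 1 ℚ.<_) y≡ k<y))

¬¬-least : ∀ {P : ℕ → Set} {m₀} → P m₀ → ¬ ¬ (∃[ m ] (P m × ∀ {j} → j < m → ¬ P j))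
¬¬-least {P} {m₀} pm₀ ∄least = none m₀ pm₀
  where
  none : ∀ m → ¬ P m
  none = <-rec (λ m → ¬ P m) λ m below pm → ∄least (m , pm , λ j<m → below j<m)

¬¬-IsMinCard : ∀ {n} {P : Subset n → Set} {B} → P B → ¬ ¬ (∃[ m ] (IsMinCard P m × m ≤ ∣ B ∣))
¬¬-IsMinCard {B = B} pB ∄min = ¬¬-least (B , pB , refl) λ (m , witness , least) →
  let minimal = λ B′ pB′ → ℕ.≮⇒≥ λ ∣B′∣<m → least ∣B′∣<m (B′ , pB′ , refl)
  in ∄min (m , (witness , minimal) , minimal B pB)

r*Z⁻≤Z₍r₎ : ∀ {n} (G : SimpleGraph n) r {k m} → ZminusIs G k → ZfoldIs G r m → r * k ≤ m
r*Z⁻≤Z₍r₎ G r (_ , k≤) ((B , B-forcing , refl) , _) = ℕ.≤-trans (ℕ.*-monoʳ-≤ r (k≤ S skew)) bound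
  where open SkewShadow (shadow G r B-forcing)

-- Doubly negated: IsFoldForcingSet is not decidable, so Z_(r) exists only classically.
-- That is enough, as the bound is only used to refute y > Z⁻.
Z₍r₎≤r*Z⁻+n : ∀ {n} (G : SimpleGraph n) r-1 {k} → ZminusIs G k →
              ¬ ¬ (∃[ m ] (ZfoldIs G (suc r-1) m × m ≤ k * suc r-1 + n))
Z₍r₎≤r*Z⁻+n G r-1 ((S , S-forcing , refl) , _) ∄m =
  ¬¬-IsMinCard (inflate-forcing G r-1 S-forcing) λ (m , Zm , m≤) →
    ∄m (m , Zm , ℕ.≤-trans m≤ (∣inflate∣≤ G r-1 S))

theorem3p18 : (n : ℕ) (G : SimpleGraph n) (k : ℕ) → ZminusIs G k → ZfIs G ((+ k) / 1)
theorem3p18 n G k Z⁻≡k = lower-bound , greatest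
  where
  lower-bound : ∀ x → ZfRatio G x → (+ k) / 1 ℚ.≤ x
  lower-bound _ (r-1 , m , Zm , refl) = +/≤+/⁺ {k} {m}
    (subst₂ _≤_ (ℕ.*-comm (suc r-1) k) (sym (ℕ.*-identityʳ m)) (r*Z⁻≤Z₍r₎ G (suc r-1) Z⁻≡k Zm))
  greatest : ∀ y → (∀ x → ZfRatio G x → y ℚ.≤ x) → y ℚ.≤ (+ k) / 1
  greatest y y-lower with y ℚ.≤? (+ k) / 1
  ... | yes y≤k = y≤k
  ... | no  y≰k = ⊥-elim (Z₍r₎≤r*Z⁻+n G (n * ↧ₙ y) Z⁻≡k λ (m , Zm , m≤) →
    ℚ.<-irrefl refl (ℚ.<-≤-trans (/-<-of-small-excess {k} {n} y (ℚ.≰⇒> y≰k) m≤)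
                                 (y-lower _ (n * ↧ₙ y , m , Zm , refl))))
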